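{- Let $G$ be a graph of order $n\geq 5$ with edge-connectivity $\lambda(G)$. Then $\left\lfloor \frac{\lambda(G)}{n-2}\right\rfloor\leq \mu_{n-2}(G)\leq \left\lceil\frac{\lambda(G)}{n-2}\right\rceil$.
   Context: For a graph $G$ and $S\subseteq V(G)$ with $|S|\geq 2$, a pendant $S$-Steiner tree is a subgraph of $G$ that is a tree whose vertex set contains $S$ and in which every vertex of $S$ has degree exactly $1$. $\mu_G(S)$ is the maximum number of pairwise edge-disjoint pendant $S$-Steiner trees in $G$, and for $2\leq k\leq |V(G)|$, $\mu_k(G)=\min\{\mu_G(S): S\subseteq V(G),|S|=k\}$. $\lambda(G)$ denotes the (classical) edge-connectivity of $G$ (with $\lambda(G)=0$ if $G$ is disconnected). -}

module Defs where

open import Data.Nat using (ℕ; zero; suc; _+_; _≤_; _<ᵇ_)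
open import Data.Nat.DivMod using (_/_)
open import Data.Bool using (Bool; true; false; T; if_then_else_; _∧_; not)
open import Data.Empty using (⊥)
open import Data.Fin using (Fin; zero; suc; toℕ; inject₁; fromℕ)
open import Data.List using (List; map; allFin)
open import Data.Nat.ListAction using (sum)
open import Data.Product using (Σ; _×_; ∃; ∃-syntax)
open import Relation.Nullary using (¬_)
open import Relation.Binary.PropositionalEquality using (_≡_; _≢_)
open import Function.Definitions using (Injective)

record Graph (n : ℕ) : Set where
  field
    adj    : Fin n → Fin n → Bool
    sym    : ∀ u v → adj u v ≡ adj v u
    irrefl : ∀ u → adj u u ≡ false
open Graph public

count : ∀ {n} → (Fin n → Bool) → ℕ
count {n} p = sum (map (λ i → if p i then 1 else 0) (allFin n))

edgeCount : ∀ {n} → (Fin n → Fin n → Bool) → ℕ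
edgeCount {n} F = sum (map (λ u → count (λ v → F u v ∧ (toℕ u <ᵇ toℕ v))) (allFin n))

data Reach {n : ℕ} (E : Fin n → Fin n → Bool) : Fin n → Fin n → Set where
  here : ∀ {u} → Reach E u u
  step : ∀ {u w v} → T (E u w) → Reach E w v → Reach E u v

record Subgraph {n : ℕ} (G : Graph n) : Set where
  field
    vs      : Fin n → Bool
    es      : Fin n → Fin n → Bool
    es-sym  : ∀ u v → es u v ≡ es v u
    es-adj  : ∀ u v → T (es u v) → T (adj G u v)
    es-endp : ∀ u v → T (es u v) → T (vs u)
open Subgraph public

degree : ∀ {n} {G : Graph n} → Subgraph G → Fin n → ℕ
degree H u = count (λ v → es H u v)

Connected : ∀ {n} {G : Graph n} → Subgraph G → Set
Connected {n} H = ∀ (u v : Fin n) → T (vs H u) → T (vs H v) → Reach (es H) u v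

-- a cycle of length k+3 in H: distinct vertices c0,…,c(k+2), consecutive ones
-- adjacent in H and c(k+2) adjacent to c0
HasCycle : ∀ {n} {G : Graph n} → Subgraph G → Set
HasCycle {n} H =
  ∃[ k ] Σ (Fin (suc (suc (suc k))) → Fin n) λ c → (Injective _≡_ _≡_ c ×
     ((i : Fin (suc (suc k))) → T (es H (c (inject₁ i)) (c (suc i)))) ×
     T (es H (c (fromℕ (suc (suc k)))) (c zero)))

IsTree : ∀ {n} {G : Graph n} → Subgraph G → Set
IsTree H = Connected H × ¬ HasCycle H

IsPendantSteinerTree : ∀ {n} {G : Graph n} → (Fin n → Bool) → Subgraph G → Set
IsPendantSteinerTree {n} S H =
  IsTree H × (∀ (s : Fin n) → T (S s) → T (vs H s) × degree H s ≡ 1)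

EdgeDisjoint : ∀ {n} {G : Graph n} → Subgraph G → Subgraph G → Set
EdgeDisjoint {n} H K = ∀ (u v : Fin n) → T (es H u v) → T (es K u v) → ⊥

Packing : ∀ {n} (G : Graph n) → (Fin n → Bool) → ℕ → Set
Packing G S m =
  Σ (Fin m → Subgraph G) λ Ts →
    (∀ i → IsPendantSteinerTree S (Ts i)) ×
    (∀ i j → i ≢ j → EdgeDisjoint (Ts i) (Ts j))

IsMuS : ∀ {n} (G : Graph n) → (Fin n → Bool) → ℕ → Set
IsMuS G S m = Packing G S m × (∀ m' → Packing G S m' → m' ≤ m)

IsMuK : ∀ {n} → ℕ → Graph n → ℕ → Set
IsMuK {n} k G m =
  (∀ (S : Fin n → Bool) → count S ≡ k → ∃[ m' ] (IsMuS G S m' × m ≤ m')) ×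
  (∃[ S ] (count S ≡ k × IsMuS G S m))

removeEdges : ∀ {n} → Graph n → (Fin n → Fin n → Bool) → Fin n → Fin n → Bool
removeEdges G F u v = adj G u v ∧ not (F u v)

IsEdgeSet : ∀ {n} → Graph n → (Fin n → Fin n → Bool) → Set
IsEdgeSet {n} G F = (∀ u v → F u v ≡ F v u) × (∀ u v → T (F u v) → T (adj G u v))

DisconnectedAfter : ∀ {n} → Graph n → (Fin n → Fin n → Bool) → Set
DisconnectedAfter {n} G F = ∃[ u ] ∃[ v ] ¬ Reach (removeEdges G F) u v

-- l = λ(G): minimum size of an edge set whose removal disconnects G
-- (0 if G is already disconnected)
IsEdgeConnectivity : ∀ {n} → Graph n → ℕ → Set
IsEdgeConnectivity G l =
  (∃[ F ] (IsEdgeSet G F × DisconnectedAfter G F × edgeCount F ≡ l)) ×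
  (∀ F → IsEdgeSet G F → DisconnectedAfter G F → l ≤ edgeCount F)

-- floor and ceiling of a / b (b > 0; value 0 for b = 0, unused)
floorDiv : ℕ → ℕ → ℕ
floorDiv a zero    = 0
floorDiv a (suc b) = a / suc b

ceilDiv : ℕ → ℕ → ℕ
ceilDiv a zero    = 0
ceilDiv a (suc b) = (a + b) / suc b

-- Write d = n − 2; a terminal set S with |S| = d misses exactly two vertices. In a
-- pendant S-tree with |S| ≥ 3 the unique neighbour of a terminal b lies outside S, and
-- in edge-disjoint trees these neighbours are distinct, so μ(S) ≤ |N(b) ∖ S| ≤ 2.
-- Lower bound: λ ≤ δ ≤ n − 1 < 2d, so only λ ≥ d needs an argument; then δ ≥ n − 2, and
-- the double star joining every terminal to one of the two missed vertices x, y (plus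
-- the edge xy if present) is a pendant S-tree.
-- Upper bound: if λ = 0, some S of size d contains two vertices in different components,
-- so μ = 0. If 0 < λ ≤ d, G is not complete (there λ = n − 1); for a non-adjacent pair
-- a, b and a third vertex w, the set S = V ∖ {a, w} leaves b the single outside
-- neighbour w, so μ ≤ 1. If λ > d, then ⌈λ/d⌉ ≥ 2 ≥ μ.
module Submission where

open import Defs renaming (sym to adj-sym)
import Algebra.Properties.CommutativeMonoid.Sum as MonoidSum
open import Data.Bool using (Bool; true; false; T; if_then_else_; _∧_; _∨_; not)
open import Data.Bool.Properties using (T-∧; T-∨; ∨-comm)
open import Data.Empty using (⊥; ⊥-elim)
open import Data.Fin using (Fin; zero; suc; toℕ; inject≤; inject₁; fromℕ)
open import Data.Fin.Properties using (_≟_; any?; toℕ-injective; inject≤-injective)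
import Data.Fin.Properties as Fin
import Data.Nat.Properties as ℕ
open import Data.List using (map; allFin; tabulate)
open import Data.List.Properties using (map-tabulate)
open import Data.Nat using (ℕ; zero; suc; _+_; _*_; _<?_; _≤?_; _∸_; _≤_; _<_; z≤n; s≤s; s≤s⁻¹; z<s; _<ᵇ_)
open import Data.Nat.ListAction using (sum)
open import Data.Nat.Properties hiding (_≟_)
open import Data.Nat.DivMod using (_/_; m<n⇒m/n≡0; m<n*o⇒m/o<n; /-monoˡ-≤; n/n≡1; m*n/n≡m)
open import Data.Product using (_×_; _,_; proj₁; proj₂; ∃-syntax)
open import Data.Sum using (_⊎_; inj₁; inj₂; [_,_])
import Data.Sum as Sum
open import Function using (_∘_; id; flip)
open import Function.Bundles using (Equivalence)
open import Function.Definitions using (Injective)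
open import Relation.Nullary using (¬_; yes; no; does; ¬?; _×-dec_)
open import Relation.Nullary.Decidable using (T?)
open import Relation.Binary.PropositionalEquality using (_≡_; _≢_; refl; sym; trans; cong; cong₂; subst; subst₂; module ≡-Reasoning)

open MonoidSum +-0-commutativeMonoid using (sum-syntax; ∑-distrib-+; ∑-comm; sum-cong-≗; sum-replicate-zero)
open import Algebra.Properties.CommutativeSemigroup +-commutativeSemigroup using (x∙yz≈y∙xz)

private variable n m : ℕ

infix 4 _∈_ _∉_
_∈_ : Fin n → (Fin n → Bool) → Set
x ∈ p = T (p x)

_∉_ : Fin n → (Fin n → Bool) → Set
x ∉ p = ¬ x ∈ p

full : Fin n → Bool
full _ = true

infixl 6 _-_
_-_ : (Fin n → Bool) → Fin n → Fin n → Bool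
(p - x) i = if does (i ≟ x) then false else p i

-- Counting the elements of a Boolean predicate on Fin n

∉⇒∈-complement : (p : Fin n → Bool) {x : Fin n} → x ∉ p → x ∈ not ∘ p
∉⇒∈-complement p {x} x∉p with p x
... | false = _
... | true  = x∉p _

∈-complement⇒∉ : (p : Fin n → Bool) {x : Fin n} → x ∈ not ∘ p → x ∉ p
∈-complement⇒∉ p {x} x∈∁p with p x
... | false = λ ()

ind : Bool → ℕ
ind b = if b then 1 else 0

sum-map-allFin : (f : Fin n → ℕ) → sum (map f (allFin n)) ≡ ∑[ i < n ] f i
sum-map-allFin f = trans (cong sum (map-tabulate id f)) (sum-tabulate f)
  where
  sum-tabulate : ∀ {n} (f : Fin n → ℕ) → sum (tabulate f) ≡ ∑[ i < n ] f i
  sum-tabulate {zero}  f = refl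
  sum-tabulate {suc n} f = cong (f zero +_) (sum-tabulate (f ∘ suc))

count≡∑ : (p : Fin n → Bool) → count p ≡ ∑[ i < n ] ind (p i)
count≡∑ p = sum-map-allFin (ind ∘ p)

∑-mono-≤ : {f g : Fin n → ℕ} → (∀ i → f i ≤ g i) → ∑[ i < n ] f i ≤ ∑[ i < n ] g i
∑-mono-≤ {zero}  f≤g = z≤n
∑-mono-≤ {suc n} f≤g = +-mono-≤ (f≤g zero) (∑-mono-≤ (f≤g ∘ suc))

∑-const-1 : ∀ n → ∑[ i < n ] 1 ≡ n
∑-const-1 zero    = refl
∑-const-1 (suc n) = cong suc (∑-const-1 n)

∑-split : (f : Fin n → ℕ) (x : Fin n) →
          ∑[ i < n ] f i ≡ f x + ∑[ i < n ] (if does (i ≟ x) then 0 else f i)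
∑-split f zero    = refl
∑-split f (suc x) = begin
  f zero + ∑[ i < _ ] f (suc i)               ≡⟨ cong (f zero +_) (∑-split (f ∘ suc) x) ⟩
  f zero + (f (suc x) + ∑[ i < _ ] g (suc i)) ≡⟨ x∙yz≈y∙xz (f zero) (f (suc x)) _ ⟩
  f (suc x) + (f zero + ∑[ i < _ ] g (suc i)) ∎
  where
  open ≡-Reasoning
  g : Fin _ → ℕ
  g i = if does (i ≟ suc x) then 0 else f i

count-split : (p : Fin n → Bool) (x : Fin n) → count p ≡ ind (p x) + count (p - x)
count-split p x = begin
  count p                                                  ≡⟨ count≡∑ p ⟩
  ∑[ i < _ ] ind (p i)                                     ≡⟨ ∑-split (ind ∘ p) x ⟩
  ind (p x) + ∑[ i < _ ] (if does (i ≟ x) then 0 else ind (p i)) ≡⟨ cong (ind (p x) +_) (sum-cong-≗ removed) ⟩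
  ind (p x) + ∑[ i < _ ] ind ((p - x) i)                   ≡⟨ cong (ind (p x) +_) (count≡∑ (p - x)) ⟨
  ind (p x) + count (p - x)                                ∎
  where
  open ≡-Reasoning
  removed : ∀ i → (if does (i ≟ x) then 0 else ind (p i)) ≡ ind ((p - x) i)
  removed i with does (i ≟ x)
  ... | true  = refl
  ... | false = refl

count-complement : (p : Fin n → Bool) → count p + count (not ∘ p) ≡ n
count-complement {n} p = begin
  count p + count (not ∘ p)                        ≡⟨ cong₂ _+_ (count≡∑ p) (count≡∑ (not ∘ p)) ⟩
  ∑[ i < n ] ind (p i) + ∑[ i < n ] ind (not (p i)) ≡⟨ ∑-distrib-+ (ind ∘ p) (ind ∘ not ∘ p) ⟨
  ∑[ i < n ] (ind (p i) + ind (not (p i)))          ≡⟨ sum-cong-≗ (λ i → one (p i)) ⟩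
  ∑[ i < n ] 1                                     ≡⟨ ∑-const-1 n ⟩
  n                                                ∎
  where
  open ≡-Reasoning
  one : ∀ b → ind b + ind (not b) ≡ 1
  one true  = refl
  one false = refl

count≤n : (p : Fin n → Bool) → count p ≤ n
count≤n p = subst (count p ≤_) (count-complement p) (m≤m+n (count p) _)

count-mono : {p q : Fin n → Bool} → (∀ i → i ∈ p → i ∈ q) → count p ≤ count q
count-mono {p = p} {q} p⊆q = subst₂ _≤_ (sym (count≡∑ p)) (sym (count≡∑ q)) (∑-mono-≤ ind-mono)
  where
  ind-mono : ∀ i → ind (p i) ≤ ind (q i)
  ind-mono i with p i | q i | p⊆q i
  ... | false | _     | _  = z≤n
  ... | true  | true  | _  = ≤-refl
  ... | true  | false | pq = ⊥-elim (pq _)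

count-full : count (full {n}) ≡ n
count-full {n} = trans (count≡∑ (full {n})) (∑-const-1 n)

count-empty : {p : Fin n → Bool} → (∀ i → i ∉ p) → count p ≡ 0
count-empty {n} {p} p∅ = trans (count≡∑ p) (trans (sum-cong-≗ ind≡0) (sum-replicate-zero n))
  where
  ind≡0 : ∀ i → ind (p i) ≡ 0
  ind≡0 i with p i | p∅ i
  ... | false | _   = refl
  ... | true  | i∉p = ⊥-elim (i∉p _)

∈-remove : (p : Fin n → Bool) {x y : Fin n} → x ∈ p → x ≢ y → x ∈ p - y
∈-remove p {x} {y} x∈p x≢y with x ≟ y
... | yes x≡y = x≢y x≡y
... | no _    = x∈p

remove-⊆ : (p : Fin n → Bool) {x y : Fin n} → x ∈ p - y → x ∈ p × x ≢ y
remove-⊆ p {x} {y} x∈p-y with x ≟ y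
... | no x≢y = x∈p-y , x≢y

count-remove-member : (p : Fin n → Bool) {x : Fin n} → x ∈ p → count p ≡ suc (count (p - x))
count-remove-member p {x} x∈p with p x | count-split p x
... | true | split = split

count≤suc-remove : (p : Fin n → Bool) (x : Fin n) → count p ≤ suc (count (p - x))
count≤suc-remove p x with p x | count-split p x
... | true  | split = ≤-reflexive split
... | false | split = m≤n⇒m≤1+n (≤-reflexive split)

count-witness : (p : Fin n → Bool) → 0 < count p → ∃[ x ] x ∈ p
count-witness p 0<count with any? (λ x → T? (p x))
... | yes x∈p = x∈p
... | no  p∅  = ⊥-elim (<⇒≢ 0<count (sym (count-empty (λ x x∈p → p∅ (x , x∈p)))))

member⇒0<count : (p : Fin n → Bool) {x : Fin n} → x ∈ p → 0 < count p
member⇒0<count p x∈p = subst (0 <_) (sym (count-remove-member p x∈p)) z<s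

count-full-minus-one : (x : Fin n) → count (full - x) ≡ n ∸ 1
count-full-minus-one {n} x = cong (_∸ 1) (trans (sym (count-remove-member (full {n}) {x} _)) (count-full {n}))

count-full-minus-two : {x y : Fin n} → x ≢ y → count (full - x - y) ≡ n ∸ 2
count-full-minus-two {n} {x} {y} x≢y = begin
  count (full - x - y)                   ≡⟨ m+n∸m≡n 2 _ ⟨
  suc (suc (count (full - x - y))) ∸ 2   ≡⟨ cong (λ c → suc c ∸ 2) (count-remove-member (full - x) {y} (∈-remove full _ (x≢y ∘ sym))) ⟨
  suc (count (full - x)) ∸ 2             ≡⟨ cong (_∸ 2) (count-remove-member (full {n}) {x} _) ⟨
  count (full {n}) ∸ 2                   ≡⟨ cong (_∸ 2) (count-full {n}) ⟩
  n ∸ 2                                  ∎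
  where open ≡-Reasoning

count≡1⇒unique : (p : Fin n → Bool) → count p ≡ 1 → ∀ {x y} → x ∈ p → y ∈ p → x ≡ y
count≡1⇒unique p count≡1 {x} {y} x∈p y∈p with x ≟ y
... | yes x≡y = x≡y
... | no  x≢y = ⊥-elim (<⇒≢ (member⇒0<count (p - x) (∈-remove p y∈p (x≢y ∘ sym)))
                            (sym (suc-injective (trans (sym (count-remove-member p x∈p)) count≡1))))

count≤1 : (p : Fin n → Bool) (w : Fin n) → (∀ v → v ∈ p → v ≡ w) → count p ≤ 1
count≤1 p w only-w = subst (count p ≤_) (cong suc (count-empty rest∅)) (count≤suc-remove p w)
  where
  rest∅ : ∀ v → v ∉ p - w
  rest∅ v v∈ = let (v∈p , v≢w) = remove-⊆ p v∈ in v≢w (only-w v v∈p)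

count≡1 : (p : Fin n → Bool) {w : Fin n} → w ∈ p → (∀ v → v ∈ p → v ≡ w) → count p ≡ 1
count≡1 p w∈p only-w = ≤-antisym (count≤1 p _ only-w) (member⇒0<count p w∈p)

count-remove-pred : (p : Fin n → Bool) {x : Fin n} → x ∈ p → count p ≡ suc m → count (p - x) ≡ m
count-remove-pred p x∈p count≡ = suc-injective (trans (sym (count-remove-member p x∈p)) count≡)

ExactlyTwo : (Fin n → Bool) → Set
ExactlyTwo p = ∃[ x ] ∃[ y ] (x ≢ y × x ∈ p × y ∈ p × (∀ z → z ∈ p → z ≡ x ⊎ z ≡ y))

count≡2⇒ExactlyTwo : (p : Fin n → Bool) → count p ≡ 2 → ExactlyTwo p
count≡2⇒ExactlyTwo p count≡2 = with-first (count-witness p (subst (0 <_) (sym count≡2) z<s))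
  where
  with-first : ∃[ x ] x ∈ p → ExactlyTwo p
  with-first (x , x∈p) = with-second (count-witness (p - x) (subst (0 <_) (sym count-p-x≡1) z<s))
    where
    count-p-x≡1 : count (p - x) ≡ 1
    count-p-x≡1 = count-remove-pred p x∈p count≡2
    with-second : ∃[ y ] y ∈ p - x → ExactlyTwo p
    with-second (y , y∈p-x) = x , y , (proj₂ (remove-⊆ p y∈p-x) ∘ sym) , x∈p , proj₁ (remove-⊆ p y∈p-x) , x-or-y
      where
      x-or-y : ∀ z → z ∈ p → z ≡ x ⊎ z ≡ y
      x-or-y z z∈p with z ≟ x | z ≟ y
      ... | yes z≡x | _       = inj₁ z≡x
      ... | no _    | yes z≡y = inj₂ z≡y
      ... | no z≢x  | no z≢y  = ⊥-elim (<⇒≢ (member⇒0<count (p - x - y) {z} (∈-remove (p - x) {z} (∈-remove p z∈p z≢x) z≢y))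
                                          (sym (count-remove-pred (p - x) y∈p-x count-p-x≡1)))

three-members⇒3≤count : (p : Fin n → Bool) {x y z : Fin n} → x ≢ y → x ≢ z → y ≢ z →
                        x ∈ p → y ∈ p → z ∈ p → 3 ≤ count p
three-members⇒3≤count p {x} {y} {z} x≢y x≢z y≢z x∈p y∈p z∈p = begin
  3                             ≤⟨ s≤s (s≤s (member⇒0<count (p - x - y) {z} z∈p-x-y)) ⟩
  suc (suc (count (p - x - y))) ≡⟨ cong suc (count-remove-member (p - x) {y} y∈p-x) ⟨
  suc (count (p - x))           ≡⟨ count-remove-member p x∈p ⟨
  count p                       ∎
  where
  open ≤-Reasoning
  y∈p-x : y ∈ p - x
  y∈p-x = ∈-remove p y∈p (x≢y ∘ sym)
  z∈p-x-y : z ∈ p - x - y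
  z∈p-x-y = ∈-remove (p - x) (∈-remove p z∈p (x≢z ∘ sym)) (y≢z ∘ sym)

member-avoiding : (p : Fin n → Bool) → 3 ≤ count p → ∀ a b → ∃[ c ] (c ∈ p × c ≢ a × c ≢ b)
member-avoiding p 3≤count a b =
  let (c , c∈p-a-b) = count-witness (p - a - b) 0<rest
      (c∈p-a , c≢b) = remove-⊆ (p - a) c∈p-a-b
      (c∈p , c≢a)   = remove-⊆ p c∈p-a
  in c , c∈p , c≢a , c≢b
  where
  0<rest : 0 < count (p - a - b)
  0<rest = s≤s⁻¹ (s≤s⁻¹ (begin
    3                             ≤⟨ 3≤count ⟩
    count p                       ≤⟨ count≤suc-remove p a ⟩
    suc (count (p - a))           ≤⟨ s≤s (count≤suc-remove (p - a) b) ⟩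
    suc (suc (count (p - a - b))) ∎))
    where open ≤-Reasoning

injective⇒≤count : (p : Fin n → Bool) (f : Fin m → Fin n) → Injective _≡_ _≡_ f →
                   (∀ i → f i ∈ p) → m ≤ count p
injective⇒≤count {m = zero}  p f f-inj f∈p = z≤n
injective⇒≤count {m = suc m} p f f-inj f∈p =
  subst (suc m ≤_) (sym (count-remove-member p (f∈p zero)))
        (s≤s (injective⇒≤count (p - f zero) (f ∘ suc) (Fin.suc-injective ∘ f-inj) rest))
  where
  rest : ∀ i → f (suc i) ∈ p - f zero
  rest i = ∈-remove p (f∈p (suc i)) (λ eq → Fin.0≢1+n (sym (f-inj eq)))

handshake : (F : Fin n → Fin n → Bool) → (∀ u v → F u v ≡ F v u) → (∀ u → F u u ≡ false) →
            ∑[ u < n ] count (F u) ≡ edgeCount F + edgeCount F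
handshake {n} F F-sym F-irrefl = begin
  ∑[ u < n ] count (F u)                                  ≡⟨ sum-cong-≗ (count≡∑ ∘ F) ⟩
  ∑[ u < n ] ∑[ v < n ] ind (F u v)                       ≡⟨ sum-cong-≗ (λ u → sum-cong-≗ (split-by-order u)) ⟩
  ∑[ u < n ] ∑[ v < n ] (up u v + up v u)                 ≡⟨ sum-cong-≗ (λ u → ∑-distrib-+ (up u) (λ v → up v u)) ⟩
  ∑[ u < n ] (∑[ v < n ] up u v + ∑[ v < n ] up v u)      ≡⟨ ∑-distrib-+ (λ u → ∑[ v < n ] up u v) _ ⟩
  ∑[ u < n ] ∑[ v < n ] up u v + ∑[ u < n ] ∑[ v < n ] up v u
                                                          ≡⟨ cong (∑[ u < n ] ∑[ v < n ] up u v +_) (∑-comm (λ u v → up v u)) ⟩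
  ∑[ u < n ] ∑[ v < n ] up u v + ∑[ v < n ] ∑[ u < n ] up v u
                                                          ≡⟨ cong₂ _+_ edgeCount≡ edgeCount≡ ⟨
  edgeCount F + edgeCount F                               ∎
  where
  open ≡-Reasoning
  up : Fin n → Fin n → ℕ
  up u v = ind (F u v ∧ (toℕ u <ᵇ toℕ v))
  edgeCount≡ : edgeCount F ≡ ∑[ u < n ] ∑[ v < n ] up u v
  edgeCount≡ = trans (sum-map-allFin (λ u → count (λ v → F u v ∧ (toℕ u <ᵇ toℕ v))))
                     (sum-cong-≗ (λ u → count≡∑ (λ v → F u v ∧ (toℕ u <ᵇ toℕ v))))
  ind-by-orientation : ∀ b c c′ → (T c → T c′ → ⊥) → (¬ T c → ¬ T c′ → b ≡ false) →
                       ind b ≡ ind (b ∧ c) + ind (b ∧ c′)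
  ind-by-orientation false c     c′    _    _    = refl
  ind-by-orientation true  true  true  both _    = ⊥-elim (both _ _)
  ind-by-orientation true  true  false _    _    = refl
  ind-by-orientation true  false true  _    _    = refl
  ind-by-orientation true  false false _ neither with neither (λ ()) (λ ())
  ... | ()
  split-by-order : ∀ u v → ind (F u v) ≡ up u v + up v u
  split-by-order u v rewrite F-sym v u = ind-by-orientation (F u v) _ _
    (λ u<v v<u → <-asym (<ᵇ⇒< (toℕ u) (toℕ v) u<v) (<ᵇ⇒< (toℕ v) (toℕ u) v<u))
    (λ u≮v v≮u → subst (λ w → F u w ≡ false)
                   (toℕ-injective (≤-antisym (≮⇒≥ (v≮u ∘ <⇒<ᵇ)) (≮⇒≥ (u≮v ∘ <⇒<ᵇ)))) (F-irrefl u))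

≤-half : ∀ {a b} → a + a ≤ b + b → a ≤ b
≤-half a+a≤b+b = ≮⇒≥ (λ b<a → <⇒≱ (+-mono-< b<a b<a) a+a≤b+b)

term≤∑ : (f : Fin n → ℕ) (i : Fin n) → f i ≤ ∑[ j < n ] f j
term≤∑ f i = subst (f i ≤_) (sym (∑-split f i)) (m≤m+n (f i) _)

edgeCount-at-vertex : (F : Fin n → Fin n → Bool) → (∀ u v → F u v ≡ F v u) → (∀ u → F u u ≡ false) →
                      (w : Fin n) → (∀ u v → T (F u v) → u ≡ w ⊎ v ≡ w) → edgeCount F ≤ count (F w)
edgeCount-at-vertex {n} F F-sym F-irrefl w meets-w = ≤-half (begin
  edgeCount F + edgeCount F                                       ≡⟨ handshake F F-sym F-irrefl ⟨
  ∑[ u < n ] count (F u)                                          ≡⟨ ∑-split (count ∘ F) w ⟩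
  count (F w) + ∑[ u < n ] (if does (u ≟ w) then 0 else count (F u)) ≤⟨ +-monoʳ-≤ (count (F w)) (∑-mono-≤ row≤) ⟩
  count (F w) + ∑[ u < n ] ind (F w u)                            ≡⟨ cong (count (F w) +_) (count≡∑ (F w)) ⟨
  count (F w) + count (F w)                                       ∎)
  where
  open ≤-Reasoning
  row≤ : ∀ u → (if does (u ≟ w) then 0 else count (F u)) ≤ ind (F w u)
  row≤ u with u ≟ w
  ... | yes _   = z≤n
  ... | no  u≢w = begin
    count (F u)              ≡⟨ count-split (F u) w ⟩
    ind (F u w) + count (F u - w) ≡⟨ cong₂ _+_ (cong ind (F-sym u w)) (count-empty only-w) ⟩
    ind (F w u) + 0          ≡⟨ +-identityʳ _ ⟩
    ind (F w u)              ∎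
    where
    only-w : ∀ v → v ∉ F u - w
    only-w v v∈ with remove-⊆ (F u) v∈ | meets-w u v (proj₁ (remove-⊆ (F u) v∈))
    ... | _ , v≢w | inj₁ u≡w = u≢w u≡w
    ... | _ , v≢w | inj₂ v≡w = v≢w v≡w

-- Degrees, cuts and edge connectivity

deg : Graph n → Fin n → ℕ
deg G w = count (adj G w)

edgeSet-irrefl : (G : Graph n) {F : Fin n → Fin n → Bool} → IsEdgeSet G F → ∀ u → F u u ≡ false
edgeSet-irrefl G {F} (_ , F⊆G) u with F u u in Fuu
... | false = refl
... | true  = ⊥-elim (subst T (irrefl G u) (F⊆G u u (subst T (sym Fuu) _)))

reach-map : {E E′ : Fin n → Fin n → Bool} → (∀ u v → T (E u v) → T (E′ u v)) →
            ∀ {u v} → Reach E u v → Reach E′ u v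
reach-map E⊆E′ here         = here
reach-map E⊆E′ (step e r) = step (E⊆E′ _ _ e) (reach-map E⊆E′ r)

reach-trans : {E : Fin n → Fin n → Bool} {u v w : Fin n} → Reach E u v → Reach E v w → Reach E u w
reach-trans here       r′ = r′
reach-trans (step e r) r′ = step e (reach-trans r r′)

reach-sym : {E : Fin n → Fin n → Bool} → (∀ u v → E u v ≡ E v u) → ∀ {u v} → Reach E u v → Reach E v u
reach-sym E-sym here       = here
reach-sym E-sym (step e r) = reach-trans (reach-sym E-sym r) (step (subst T (E-sym _ _) e) here)

module Star (G : Graph n) (w : Fin n) where

  star : Fin n → Fin n → Bool
  star u v = adj G u v ∧ (does (u ≟ w) ∨ does (v ≟ w))

  star-sym : ∀ u v → star u v ≡ star v u
  star-sym u v = cong₂ _∧_ (adj-sym G u v) (∨-comm (does (u ≟ w)) _)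

  star⊆adj : ∀ u v → T (star u v) → T (adj G u v)
  star⊆adj u v e = proj₁ (Equivalence.to (T-∧ {adj G u v}) e)

  star-meets-w : ∀ u v → T (star u v) → u ≡ w ⊎ v ≡ w
  star-meets-w u v e with u ≟ w | v ≟ w | proj₂ (Equivalence.to (T-∧ {adj G u v}) e)
  ... | yes u≡w | _       | _  = inj₁ u≡w
  ... | no _    | yes v≡w | _  = inj₂ v≡w
  ... | no _    | no _    | ()

  isolates-w : ∀ {v} → Reach (removeEdges G star) w v → v ≡ w
  isolates-w here = refl
  isolates-w (step {w = x} e _) with w ≟ w | adj G w x | e
  ... | yes _ | true  | ()
  ... | no w≢w | _    | _ = ⊥-elim (w≢w refl)

edgeConnectivity≤deg : (G : Graph n) {l : ℕ} → IsEdgeConnectivity G l → (v w : Fin n) → v ≢ w → l ≤ deg G w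
edgeConnectivity≤deg G (_ , minimal) v w v≢w = begin
  _               ≤⟨ minimal star (star-sym , star⊆adj) (w , v , v≢w ∘ isolates-w) ⟩
  edgeCount star  ≤⟨ edgeCount-at-vertex star star-sym (edgeSet-irrefl G (star-sym , star⊆adj)) w star-meets-w ⟩
  count (star w)  ≤⟨ count-mono (star⊆adj w) ⟩
  deg G w         ∎
  where
  open Star G w
  open ≤-Reasoning

Complete : Graph n → Set
Complete {n} G = ∀ (u v : Fin n) → u ≢ v → T (adj G u v)

-- Every vertex other than u, v has an F-edge to u or to v, and uv ∈ F: the rows of u and v
-- have n entries together and every other row is non-empty, so 2|F| ≥ n + (n − 2).
module CompleteCut (G : Graph n) (complete : Complete G) {F : Fin n → Fin n → Bool} (F-edges : IsEdgeSet G F)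
                   {u v : Fin n} (separated : ¬ Reach (removeEdges G F) u v) where

  u≢v : u ≢ v
  u≢v refl = separated here

  kept : ∀ {a b} → a ≢ b → F a b ≡ false → T (removeEdges G F a b)
  kept {a} {b} a≢b Fab≡false rewrite Fab≡false = Equivalence.from (T-∧ {adj G a b}) (complete a b a≢b , _)

  uv∈F : T (F u v)
  uv∈F with F u v in Fuv
  ... | true  = _
  ... | false = separated (step (kept u≢v Fuv) here)

  via-F : ∀ w → w ≢ u → w ≢ v → T (F u w) ⊎ T (F w v)
  via-F w w≢u w≢v with F u w in Fuw | F w v in Fwv
  ... | true  | _     = inj₁ _
  ... | false | true  = inj₂ _
  ... | false | false = ⊥-elim (separated (step (kept (w≢u ∘ sym) Fuw) (step (kept w≢v Fwv) here)))

  F-sym = proj₁ F-edges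

  cut-rows : n ≤ count (F u) + count (F v)
  cut-rows = begin
    n                                              ≡⟨ ∑-const-1 n ⟨
    ∑[ w < n ] 1                                   ≤⟨ ∑-mono-≤ hit ⟩
    ∑[ w < n ] (ind (F u w) + ind (F v w))         ≡⟨ ∑-distrib-+ (ind ∘ F u) (ind ∘ F v) ⟩
    ∑[ w < n ] ind (F u w) + ∑[ w < n ] ind (F v w) ≡⟨ cong₂ _+_ (count≡∑ (F u)) (count≡∑ (F v)) ⟨
    count (F u) + count (F v)                      ∎
    where
    open ≤-Reasoning
    ind-T : ∀ {b} → T b → 1 ≤ ind b
    ind-T {true} _ = ≤-refl
    hit : ∀ w → 1 ≤ ind (F u w) + ind (F v w)
    hit w with w ≟ u | w ≟ v
    ... | yes refl | _        = ≤-trans (ind-T (subst T (F-sym u v) uv∈F)) (m≤n+m _ _)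
    ... | no _     | yes refl = ≤-trans (ind-T uv∈F) (m≤m+n _ _)
    ... | no w≢u   | no w≢v   with via-F w w≢u w≢v
    ...   | inj₁ uw∈F = ≤-trans (ind-T uw∈F) (m≤m+n _ _)
    ...   | inj₂ wv∈F = ≤-trans (ind-T (subst T (F-sym w v) wv∈F)) (m≤n+m _ _)

  cut-other-rows : n ∸ 2 ≤ ∑[ w < n ] (if does (w ≟ v) then 0 else (if does (w ≟ u) then 0 else count (F w)))
  cut-other-rows = begin
    n ∸ 2                                ≡⟨ count-full-minus-two u≢v ⟨
    count (full - u - v)                 ≡⟨ count≡∑ (full - u - v) ⟩
    ∑[ w < n ] ind ((full - u - v) w)    ≤⟨ ∑-mono-≤ hit ⟩
    _                                    ∎
    where
    open ≤-Reasoning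
    hit : ∀ w → ind ((full - u - v) w) ≤ (if does (w ≟ v) then 0 else (if does (w ≟ u) then 0 else count (F w)))
    hit w with w ≟ v | w ≟ u
    ... | yes _ | _     = z≤n
    ... | no _  | yes _ = z≤n
    ... | no w≢v | no w≢u with via-F w w≢u w≢v
    ...   | inj₁ uw∈F = member⇒0<count (F w) {u} (subst T (F-sym u w) uw∈F)
    ...   | inj₂ wv∈F = member⇒0<count (F w) {v} wv∈F

  complete-cut-size : n ∸ 1 ≤ edgeCount F
  complete-cut-size = ≤-half (begin
    (n ∸ 1) + (n ∸ 1)                           ≤⟨ double-pred n ⟩
    n + (n ∸ 2)                                 ≤⟨ +-mono-≤ cut-rows cut-other-rows ⟩
    count (F u) + count (F v) + ∑[ w < n ] h w  ≡⟨ +-assoc (count (F u)) _ _ ⟩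
    count (F u) + (count (F v) + ∑[ w < n ] h w) ≡⟨ cong (λ c → count (F u) + (c + ∑[ w < n ] h w)) g-at-v ⟨
    count (F u) + (g v + ∑[ w < n ] h w)         ≡⟨ cong (count (F u) +_) (∑-split g v) ⟨
    count (F u) + ∑[ w < n ] g w                 ≡⟨ ∑-split (count ∘ F) u ⟨
    ∑[ w < n ] count (F w)                       ≡⟨ handshake F F-sym (edgeSet-irrefl G F-edges) ⟩
    edgeCount F + edgeCount F                    ∎)
    where
    open ≤-Reasoning
    g h : Fin n → ℕ
    g w = if does (w ≟ u) then 0 else count (F w)
    h w = if does (w ≟ v) then 0 else g w
    g-at-v : g v ≡ count (F v)
    g-at-v with v ≟ u
    ... | yes v≡u = ⊥-elim (u≢v (sym v≡u))
    ... | no _    = refl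
    double-pred : ∀ n → (n ∸ 1) + (n ∸ 1) ≤ n + (n ∸ 2)
    double-pred zero          = z≤n
    double-pred (suc zero)    = z≤n
    double-pred (suc (suc n)) = ≤-reflexive (cong suc (+-suc n n))

edgeConnectivity≡0⇒disconnected : (G : Graph n) → IsEdgeConnectivity G 0 → ∃[ u ] ∃[ v ] ¬ Reach (adj G) u v
edgeConnectivity≡0⇒disconnected {n} G ((F , F-edges , (u , v , separated) , |F|≡0) , _) =
  u , v , separated ∘ reach-map keep-all
  where
  F-empty : ∀ a b → ¬ T (F a b)
  F-empty a b ab∈F = <⇒≢ (begin-strict
    0                          <⟨ member⇒0<count (F a) ab∈F ⟩
    count (F a)                ≤⟨ term≤∑ (count ∘ F) a ⟩
    ∑[ w < n ] count (F w)     ≡⟨ handshake F (proj₁ F-edges) (edgeSet-irrefl G F-edges) ⟩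
    edgeCount F + edgeCount F  ≡⟨ cong₂ _+_ |F|≡0 |F|≡0 ⟩
    0                          ∎) refl
    where open ≤-Reasoning
  keep-all : ∀ a b → T (adj G a b) → T (removeEdges G F a b)
  keep-all a b ab∈G with F a b | F-empty a b
  ... | false | _       = Equivalence.from (T-∧ {adj G a b}) (ab∈G , _)
  ... | true  | ab∉F    = ⊥-elim (ab∉F _)

-- Pendant Steiner trees and packings

module PendantTree {G : Graph n} {S : Fin n → Bool} {H : Subgraph G} (pendant : IsPendantSteinerTree S H) where

  terminal-neighbour : ∀ {s} → s ∈ S → ∃[ x ] T (es H s x)
  terminal-neighbour {s} s∈S = count-witness (es H s) (≤-reflexive (sym (proj₂ (proj₂ pendant s s∈S))))

  terminal-neighbour-unique : ∀ {s x y} → s ∈ S → T (es H s x) → T (es H s y) → x ≡ y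
  terminal-neighbour-unique {s} s∈S = count≡1⇒unique (es H s) (proj₂ (proj₂ pendant s s∈S))

  terminal-neighbour-∉ : 3 ≤ count S → ∀ {s x} → s ∈ S → T (es H s x) → x ∉ S
  terminal-neighbour-∉ 3≤|S| {s} {x} s∈S sx∈H x∈S =
    let (c , c∈S , c≢s , c≢x) = member-avoiding S 3≤|S| s x
    in [ c≢s , c≢x ] (trapped (proj₁ (proj₁ pendant) s c (in-H s∈S) (in-H c∈S)) (inj₁ refl))
    where
    in-H : ∀ {t} → t ∈ S → T (vs H t)
    in-H t∈S = proj₁ (proj₂ pendant _ t∈S)
    xs∈H : T (es H x s)
    xs∈H = subst T (es-sym H s x) sx∈H
    trapped : ∀ {z t} → Reach (es H) z t → z ≡ s ⊎ z ≡ x → t ≡ s ⊎ t ≡ x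
    trapped here                 z∈sx        = z∈sx
    trapped (step zy∈H walk) (inj₁ refl) = trapped walk (inj₂ (terminal-neighbour-unique s∈S zy∈H sx∈H))
    trapped (step zy∈H walk) (inj₂ refl) = trapped walk (inj₁ (terminal-neighbour-unique x∈S zy∈H xs∈H))

packing-downward : {G : Graph n} {S : Fin n → Bool} {m m′ : ℕ} → m ≤ m′ → Packing G S m′ → Packing G S m
packing-downward m≤m′ (Ts , pendant , disjoint) =
  (λ i → Ts (inject≤ i m≤m′)) , (λ i → pendant (inject≤ i m≤m′)) ,
  (λ i j i≢j → disjoint _ _ (i≢j ∘ inject≤-injective m≤m′ m≤m′ i j))

maximum<bound : {G : Graph n} {S : Fin n → Bool} {μ b : ℕ} → IsMuS G S μ → ¬ Packing G S b → μ < b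
maximum<bound ((packing , _)) no-b-packing = ≰⇒> (no-b-packing ∘ flip packing-downward packing)

packing⇒reach : {G : Graph n} {S : Fin n → Bool} {m : ℕ} → Packing G S (suc m) →
                ∀ {u v} → u ∈ S → v ∈ S → Reach (adj G) u v
packing⇒reach {G = G} {S} (Ts , pendant , _) {u} {v} u∈S v∈S =
  reach-map (es-adj (Ts zero)) (proj₁ (proj₁ (pendant zero)) u v (in-tree u∈S) (in-tree v∈S))
  where
  in-tree : ∀ {t} → t ∈ S → T (vs (Ts zero) t)
  in-tree t∈S = proj₁ (proj₂ (pendant zero) _ t∈S)

packing≤outside-neighbours : {G : Graph n} {S : Fin n → Bool} {m : ℕ} → Packing G S m → 3 ≤ count S →
                             ∀ {b} → b ∈ S → m ≤ count (λ x → adj G b x ∧ not (S x))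
packing≤outside-neighbours {G = G} {S} {m} (Ts , pendant , disjoint) 3≤|S| {b} b∈S =
  injective⇒≤count _ nb nb-injective nb-outside
  where
  module Tree (i : Fin m) = PendantTree {G = G} {S} {Ts i} (pendant i)
  nb : Fin m → Fin _
  nb i = proj₁ (Tree.terminal-neighbour i b∈S)
  b-nb : ∀ i → T (es (Ts i) b (nb i))
  b-nb i = proj₂ (Tree.terminal-neighbour i b∈S)
  nb-injective : Injective _≡_ _≡_ nb
  nb-injective {i} {j} nbi≡nbj with i Fin.≟ j
  ... | yes i≡j = i≡j
  ... | no  i≢j = ⊥-elim (disjoint i j i≢j b (nb i) (b-nb i) (subst (T ∘ es (Ts j) b) (sym nbi≡nbj) (b-nb j)))
  nb-outside : ∀ i → T (adj G b (nb i) ∧ not (S (nb i)))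
  nb-outside i = Equivalence.from (T-∧ {adj G b (nb i)})
    (es-adj (Ts i) b (nb i) (b-nb i) , ∉⇒∈-complement S (Tree.terminal-neighbour-∉ i 3≤|S| b∈S (b-nb i)))

-- A pendant tree when the minimum degree is at least n − 2

in-pair-distinct : {x y a b c : Fin n} → a ≢ b → a ≢ c → b ≢ c →
                   a ≡ x ⊎ a ≡ y → b ≡ x ⊎ b ≡ y → c ≡ x ⊎ c ≡ y → ⊥
in-pair-distinct a≢b a≢c b≢c (inj₁ refl) (inj₁ refl) _           = a≢b refl
in-pair-distinct a≢b a≢c b≢c (inj₂ refl) (inj₂ refl) _           = a≢b refl
in-pair-distinct a≢b a≢c b≢c (inj₁ refl) (inj₂ refl) (inj₁ refl) = a≢c refl
in-pair-distinct a≢b a≢c b≢c (inj₁ refl) (inj₂ refl) (inj₂ refl) = b≢c refl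
in-pair-distinct a≢b a≢c b≢c (inj₂ refl) (inj₁ refl) (inj₁ refl) = b≢c refl
in-pair-distinct a≢b a≢c b≢c (inj₂ refl) (inj₁ refl) (inj₂ refl) = a≢c refl

acyclic-if-branching-in-pair : {G : Graph n} (H : Subgraph G) {x y : Fin n} →
  (∀ v {a b} → T (es H v a) → T (es H v b) → a ≢ b → v ≡ x ⊎ v ≡ y) → ¬ HasCycle H
acyclic-if-branching-in-pair H {x} {y} branching⊆xy (k , c , c-inj , path , closing) =
  in-pair-distinct (distinct λ ()) (distinct λ ()) (distinct λ ())
    (branching⊆xy _ (path zero) (flipped closing) (distinct λ ()))
    (branching⊆xy _ (flipped (path zero)) (path (suc zero)) (distinct λ ()))
    (third-branches k c-inj path closing)
  where
  flipped : ∀ {a b} → T (es H a b) → T (es H b a)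
  flipped {a} {b} = subst T (es-sym H a b)
  distinct : ∀ {i j} → i ≢ j → c i ≢ c j
  distinct i≢j = i≢j ∘ c-inj
  third-branches : ∀ k {c : Fin (3 + k) → Fin _} → Injective _≡_ _≡_ c →
    ((i : Fin (2 + k)) → T (es H (c (inject₁ i)) (c (suc i)))) → T (es H (c (fromℕ (2 + k))) (c zero)) →
    c (suc (suc zero)) ≡ x ⊎ c (suc (suc zero)) ≡ y
  third-branches zero    c-inj path closing =
    branching⊆xy _ (flipped (path (suc zero))) closing ((λ ()) ∘ c-inj)
  third-branches (suc k) c-inj path closing =
    branching⊆xy _ (flipped (path (suc zero))) (path (suc (suc zero))) ((λ ()) ∘ c-inj)

≟-sound : {i j : Fin n} → T (does (i ≟ j)) → i ≡ j
≟-sound {i = i} {j} i=j with i ≟ j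
... | yes i≡j = i≡j

≟-refl : (i : Fin n) → T (does (i ≟ i))
≟-refl i with i ≟ i
... | yes _   = _
... | no  i≢i = i≢i refl

-- Every terminal hangs from its parent hub, x or y; the hub edge xy is used exactly when K holds.
module DoubleStar (G : Graph n) (S : Fin n → Bool) {x y : Fin n} (x∉S : x ∉ S) (y∉S : y ∉ S)
                  (outside⊆xy : ∀ z → z ∉ S → z ≡ x ⊎ z ≡ y)
                  (K : Bool) (K⇒xy : T K → T (adj G x y)) (parent : Fin n → Fin n)
                  (parent-adj : ∀ s → s ∈ S → T (adj G s (parent s)))
                  (parent-hub : ∀ s → s ∈ S → parent s ≡ x ⊎ (T K × parent s ≡ y)) where

  arc : Fin n → Fin n → Bool
  arc u v = (S u ∧ does (v ≟ parent u)) ∨ (K ∧ (does (u ≟ x) ∧ does (v ≟ y)))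

  edge : Fin n → Fin n → Bool
  edge u v = arc u v ∨ arc v u

  vertex : Fin n → Bool
  vertex u = S u ∨ (does (u ≟ x) ∨ (K ∧ does (u ≟ y)))

  data Arc (u v : Fin n) : Set where
    leaf-arc : u ∈ S → v ≡ parent u → Arc u v
    hub-arc  : T K → u ≡ x → v ≡ y → Arc u v

  arc-view : ∀ {u v} → T (arc u v) → Arc u v
  arc-view {u} {v} uv∈arc with Equivalence.to (T-∨ {S u ∧ _}) uv∈arc
  ... | inj₁ leaf = let (u∈S , v=p) = Equivalence.to (T-∧ {S u}) leaf in leaf-arc u∈S (≟-sound v=p)
  ... | inj₂ hub  = let (k , u=x,v=y) = Equivalence.to (T-∧ {K}) hub
                        (u=x , v=y)   = Equivalence.to (T-∧ {does (u ≟ x)}) u=x,v=y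
                    in hub-arc k (≟-sound u=x) (≟-sound v=y)

  edge-view : ∀ {u v} → T (edge u v) → Arc u v ⊎ Arc v u
  edge-view {u} {v} uv∈edge with Equivalence.to (T-∨ {arc u v}) uv∈edge
  ... | inj₁ uv = inj₁ (arc-view uv)
  ... | inj₂ vu = inj₂ (arc-view vu)

  arc-intro : ∀ {u v} → Arc u v → T (arc u v)
  arc-intro {u} (leaf-arc u∈S refl)   =
    Equivalence.from (T-∨ {S u ∧ _}) (inj₁ (Equivalence.from (T-∧ {S u}) (u∈S , ≟-refl (parent u))))
  arc-intro {u} (hub-arc k refl refl) =
    Equivalence.from (T-∨ {S u ∧ _}) (inj₂ (Equivalence.from (T-∧ {K}) (k , Equivalence.from (T-∧ {does (u ≟ u)}) (≟-refl x , ≟-refl y))))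

  edge-intro : ∀ {u v} → Arc u v ⊎ Arc v u → T (edge u v)
  edge-intro {u} {v} = Equivalence.from (T-∨ {arc u v}) ∘ Sum.map arc-intro arc-intro

  leaf-edge : ∀ {s} → s ∈ S → T (edge s (parent s))
  leaf-edge s∈S = edge-intro (inj₁ (leaf-arc s∈S refl))

  hub-edge : T K → T (edge y x)
  hub-edge k = edge-intro (inj₂ (hub-arc k refl refl))

  edge-sym : ∀ u v → edge u v ≡ edge v u
  edge-sym u v = ∨-comm (arc u v) (arc v u)

  arc-adj : ∀ {u v} → Arc u v → T (adj G u v)
  arc-adj (leaf-arc u∈S refl)  = parent-adj _ u∈S
  arc-adj (hub-arc k refl refl) = K⇒xy k

  edge-adj : ∀ u v → T (edge u v) → T (adj G u v)
  edge-adj u v uv∈edge with edge-view uv∈edge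
  ... | inj₁ uv = arc-adj uv
  ... | inj₂ vu = subst T (adj-sym G v u) (arc-adj vu)

  x∈vertex : T (vertex x)
  x∈vertex = Equivalence.from (T-∨ {S x}) (inj₂ (Equivalence.from (T-∨ {does (x ≟ x)}) (inj₁ (≟-refl x))))

  y∈vertex : T K → T (vertex y)
  y∈vertex k = Equivalence.from (T-∨ {S y}) (inj₂ (Equivalence.from (T-∨ {does (y ≟ x)})
                 (inj₂ (Equivalence.from (T-∧ {K}) (k , ≟-refl y)))))

  S⊆vertex : ∀ {s} → s ∈ S → T (vertex s)
  S⊆vertex {s} s∈S = Equivalence.from (T-∨ {S s}) (inj₁ s∈S)

  parent∈vertex : ∀ {s} → s ∈ S → T (vertex (parent s))
  parent∈vertex s∈S with parent-hub _ s∈S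
  ... | inj₁ p≡x       = subst (T ∘ vertex) (sym p≡x) x∈vertex
  ... | inj₂ (k , p≡y) = subst (T ∘ vertex) (sym p≡y) (y∈vertex k)

  arc-endpoints : ∀ {u v} → Arc u v → T (vertex u) × T (vertex v)
  arc-endpoints (leaf-arc u∈S refl)  = S⊆vertex u∈S , parent∈vertex u∈S
  arc-endpoints (hub-arc k refl refl) = x∈vertex , y∈vertex k

  edge-endpoint : ∀ u v → T (edge u v) → T (vertex u)
  edge-endpoint u v uv∈edge with edge-view uv∈edge
  ... | inj₁ uv = proj₁ (arc-endpoints uv)
  ... | inj₂ vu = proj₂ (arc-endpoints vu)

  tree : Subgraph G
  tree = record { vs = vertex ; es = edge ; es-sym = edge-sym ; es-adj = edge-adj ; es-endp = edge-endpoint }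

  S≢hub : ∀ {s} → s ∈ S → s ≢ x × s ≢ y
  S≢hub s∈S = (λ { refl → x∉S s∈S }) , (λ { refl → y∉S s∈S })

  parent∉S : ∀ {s} → s ∈ S → parent s ∉ S
  parent∉S s∈S p∈S with parent-hub _ s∈S
  ... | inj₁ p≡x       = proj₁ (S≢hub p∈S) p≡x
  ... | inj₂ (_ , p≡y) = proj₂ (S≢hub p∈S) p≡y

  leaf-only-parent : ∀ {s v} → s ∈ S → T (edge s v) → v ≡ parent s
  leaf-only-parent s∈S sv∈edge with edge-view sv∈edge
  ... | inj₁ (leaf-arc _ v≡p)      = v≡p
  ... | inj₁ (hub-arc _ s≡x _)     = ⊥-elim (proj₁ (S≢hub s∈S) s≡x)
  ... | inj₂ (leaf-arc v∈S s≡p)    = ⊥-elim (parent∉S v∈S (subst (T ∘ S) s≡p s∈S))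
  ... | inj₂ (hub-arc _ _ s≡y)     = ⊥-elim (proj₂ (S≢hub s∈S) s≡y)

  leaf-degree : ∀ {s} → s ∈ S → degree tree s ≡ 1
  leaf-degree s∈S = count≡1 (edge _) (leaf-edge s∈S) (λ v → leaf-only-parent s∈S)

  reaches-x : ∀ u → T (vertex u) → Reach edge u x
  reaches-x u u∈vertex with Equivalence.to (T-∨ {S u}) u∈vertex
  ... | inj₁ u∈S with parent-hub u u∈S
  ...   | inj₁ p≡x       = step (leaf-edge u∈S) (subst (λ p → Reach edge p x) (sym p≡x) here)
  ...   | inj₂ (k , p≡y) = step (leaf-edge u∈S) (subst (λ p → Reach edge p x) (sym p≡y) (step (hub-edge k) here))
  reaches-x u u∈vertex | inj₂ hub with Equivalence.to (T-∨ {does (u ≟ x)}) hub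
  ... | inj₁ u=x = subst (λ w → Reach edge w x) (sym (≟-sound u=x)) here
  ... | inj₂ k∧u=y = let (k , u=y) = Equivalence.to (T-∧ {K}) k∧u=y
                     in subst (λ w → Reach edge w x) (sym (≟-sound u=y)) (step (hub-edge k) here)

  connected : Connected tree
  connected u v u∈vertex v∈vertex = reach-trans (reaches-x u u∈vertex) (reach-sym edge-sym (reaches-x v v∈vertex))

  acyclic : ¬ HasCycle tree
  acyclic = acyclic-if-branching-in-pair tree branching⊆xy
    where
    branching⊆xy : ∀ v {a b} → T (edge v a) → T (edge v b) → a ≢ b → v ≡ x ⊎ v ≡ y
    branching⊆xy v va vb a≢b with T? (S v)
    ... | yes v∈S = ⊥-elim (a≢b (trans (leaf-only-parent v∈S va) (sym (leaf-only-parent v∈S vb))))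
    ... | no  v∉S = outside⊆xy v v∉S

  packing : Packing G S 1
  packing = (λ _ → tree) , (λ _ → (connected , acyclic) , (λ s s∈S → S⊆vertex s∈S , leaf-degree s∈S)) , only-one
    where
    only-one : ∀ i j → i ≢ j → EdgeDisjoint tree tree
    only-one zero zero 0≢0 = ⊥-elim (0≢0 refl)

misses-at-most-two : (p : Fin n → Bool) → n ∸ 2 ≤ count p → ∀ {a b z} → a ≢ b → a ≢ z → b ≢ z →
                     a ∉ p → b ∉ p → z ∈ p
misses-at-most-two {n} p n-2≤|p| {a} {b} {z} a≢b a≢z b≢z a∉p b∉p with T? (p z)
... | yes z∈p = z∈p
... | no  z∉p = ⊥-elim (<⇒≱ 3≤|∁p| |∁p|≤2)
  where
  3≤|∁p| : 3 ≤ count (not ∘ p)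
  3≤|∁p| = three-members⇒3≤count (not ∘ p) a≢b a≢z b≢z
             (∉⇒∈-complement p a∉p) (∉⇒∈-complement p b∉p) (∉⇒∈-complement p z∉p)
  |∁p|≤2 : count (not ∘ p) ≤ 2
  |∁p|≤2 = +-cancelˡ-≤ (n ∸ 2) _ 2 (begin
    n ∸ 2 + count (not ∘ p)   ≤⟨ +-monoˡ-≤ _ n-2≤|p| ⟩
    count p + count (not ∘ p) ≡⟨ count-complement p ⟩
    n                         ≤⟨ m≤n+m∸n n 2 ⟩
    2 + (n ∸ 2)               ≡⟨ +-comm 2 (n ∸ 2) ⟩
    n ∸ 2 + 2                 ∎)
    where open ≤-Reasoning

min-degree⇒packing : (G : Graph n) (S : Fin n → Bool) → count (not ∘ S) ≡ 2 →
                     (∀ w → n ∸ 2 ≤ deg G w) → Packing G S 1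
min-degree⇒packing {n} G S |∁S|≡2 min-degree with count≡2⇒ExactlyTwo (not ∘ S) |∁S|≡2
... | x , y , x≢y , x∈∁S , y∈∁S , ∁S⊆xy = hubs-joined-or-not
  where
  x∉S : x ∉ S
  x∉S = ∈-complement⇒∉ S x∈∁S
  y∉S : y ∉ S
  y∉S = ∈-complement⇒∉ S y∈∁S
  outside⊆xy : ∀ z → z ∉ S → z ≡ x ⊎ z ≡ y
  outside⊆xy z z∉S = ∁S⊆xy z (∉⇒∈-complement S z∉S)
  -- A vertex of degree at least n − 2 is adjacent to all but itself and one other vertex.
  -- If xy is an edge, a terminal not adjacent to x is adjacent to y; otherwise x is
  -- adjacent to every terminal.
  hubs-joined-or-not : Packing G S 1
  hubs-joined-or-not with adj G x y in xy∈G
  ... | true  = DoubleStar.packing G S x∉S y∉S outside⊆xy true (λ _ → subst T (sym xy∈G) _)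
                  parent parent-adj parent-hub
    where
    parent : Fin n → Fin n
    parent s = if adj G s x then x else y
    parent-adj : ∀ s → s ∈ S → T (adj G s (parent s))
    parent-adj s s∈S with adj G s x in sx∈G
    ... | true  = subst T (sym sx∈G) _
    ... | false = misses-at-most-two (adj G s) (min-degree s) (λ { refl → x∉S s∈S }) (λ { refl → y∉S s∈S }) x≢y
                    (subst T (irrefl G s)) (subst T sx∈G)
    parent-hub : ∀ s → s ∈ S → parent s ≡ x ⊎ (T true × parent s ≡ y)
    parent-hub s _ with adj G s x
    ... | true  = inj₁ refl
    ... | false = inj₂ (_ , refl)
  ... | false = DoubleStar.packing G S x∉S y∉S outside⊆xy false (λ ()) (λ _ → x) x-adj (λ _ _ → inj₁ refl)
    where
    x-adj : ∀ s → s ∈ S → T (adj G s x)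
    x-adj s s∈S = subst T (adj-sym G x s)
      (misses-at-most-two (adj G x) (min-degree x) x≢y (λ { refl → x∉S s∈S }) (λ { refl → y∉S s∈S })
        (subst T (irrefl G x)) (subst T xy∈G))

-- μₙ₋₂ versus λ

μₖ≤ : {G : Graph n} {k m c : ℕ} → IsMuK k G m → (S : Fin n → Bool) → count S ≡ k → ¬ Packing G S (suc c) → m ≤ c
μₖ≤ (minimal , _) S |S|≡k no-packing with minimal S |S|≡k
... | μ , μ-max , m≤μ = ≤-trans m≤μ (s≤s⁻¹ (maximum<bound μ-max no-packing))

outside-neighbours⇒no-packing : {G : Graph n} (S : Fin n → Bool) {b : Fin n} {c : ℕ} → 3 ≤ count S → b ∈ S →
  count (λ x → adj G b x ∧ not (S x)) ≤ c → ¬ Packing G S (suc c)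
outside-neighbours⇒no-packing S 3≤|S| b∈S ≤c packing = <⇒≱ (s≤s ≤c) (packing≤outside-neighbours packing 3≤|S| b∈S)

complete-or-nonadjacent : (G : Graph n) → Complete G ⊎ ∃[ a ] ∃[ b ] (a ≢ b × ¬ T (adj G a b))
complete-or-nonadjacent G with any? (λ a → any? (λ b → ¬? (a ≟ b) ×-dec ¬? (T? (adj G a b))))
... | yes (a , b , a≢b , ab∉G) = inj₂ (a , b , a≢b , ab∉G)
... | no  none                = inj₁ complete
  where
  complete : Complete G
  complete u v u≢v with T? (adj G u v)
  ... | yes uv∈G = uv∈G
  ... | no  uv∉G = ⊥-elim (none (u , v , u≢v , uv∉G))

∉-full-minus-two : {x a b : Fin n} → x ∉ full - a - b → x ≡ a ⊎ x ≡ b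
∉-full-minus-two {x = x} {a} {b} x∉ with x ≟ a | x ≟ b
... | yes x≡a | _       = inj₁ x≡a
... | no _    | yes x≡b = inj₂ x≡b
... | no _    | no _    = ⊥-elim (x∉ _)

disconnected⇒no-pendant-tree : (G : Graph n) → 4 ≤ n → ∀ {u v} → ¬ Reach (adj G) u v →
                               ∃[ S ] (count S ≡ n ∸ 2 × ¬ Packing G S 1)
disconnected⇒no-pendant-tree {n} G 4≤n {u} {v} u↛v =
  avoid-x (member-avoiding full (≤-trans (n≤1+n 3) (subst (4 ≤_) (sym count-full) 4≤n)) u v)
  where
  avoid-x : ∃[ x ] (x ∈ full × x ≢ u × x ≢ v) → ∃[ S ] (count S ≡ n ∸ 2 × ¬ Packing G S 1)
  avoid-x (x , _ , x≢u , x≢v) = avoid-y (member-avoiding (full - x) (subst (3 ≤_) (sym (count-full-minus-one x)) (∸-monoˡ-≤ 1 4≤n)) u v)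
    where
    avoid-y : ∃[ y ] (y ∈ full - x × y ≢ u × y ≢ v) → ∃[ S ] (count S ≡ n ∸ 2 × ¬ Packing G S 1)
    avoid-y (y , y∈full-x , y≢u , y≢v) = full - x - y , count-full-minus-two x≢y , no-packing
      where
      x≢y : x ≢ y
      x≢y = proj₂ (remove-⊆ full {y} y∈full-x) ∘ sym
      in-S : ∀ {z} → z ≢ x → z ≢ y → z ∈ full - x - y
      in-S z≢x z≢y = ∈-remove (full - x) (∈-remove full _ z≢x) z≢y
      no-packing : ¬ Packing G (full - x - y) 1
      no-packing packing = u↛v (packing⇒reach packing (in-S (x≢u ∘ sym) (y≢u ∘ sym)) (in-S (x≢v ∘ sym) (y≢v ∘ sym)))

nonadjacent⇒no-two-pendant-trees : (G : Graph n) → 5 ≤ n → ∀ {a b} → a ≢ b → ¬ T (adj G a b) →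
                                   ∃[ S ] (count S ≡ n ∸ 2 × ¬ Packing G S 2)
nonadjacent⇒no-two-pendant-trees {n} G 5≤n {a} {b} a≢b ab∉G =
  avoid-w (member-avoiding full (≤-trans (m≤n+m 3 2) (subst (5 ≤_) (sym count-full) 5≤n)) a b)
  where
  avoid-w : ∃[ w ] (w ∈ full × w ≢ a × w ≢ b) → ∃[ S ] (count S ≡ n ∸ 2 × ¬ Packing G S 2)
  avoid-w (w , _ , w≢a , w≢b) =
    full - a - w , |S|≡n-2 , outside-neighbours⇒no-packing (full - a - w) 3≤|S| b∈S (count≤1 _ w only-w)
    where
    |S|≡n-2 : count (full - a - w) ≡ n ∸ 2
    |S|≡n-2 = count-full-minus-two (w≢a ∘ sym)
    3≤|S| : 3 ≤ count (full - a - w)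
    3≤|S| = subst (3 ≤_) (sym |S|≡n-2) (∸-monoˡ-≤ 2 5≤n)
    b∈S : b ∈ full - a - w
    b∈S = ∈-remove (full - a) (∈-remove full _ (a≢b ∘ sym)) (w≢b ∘ sym)
    only-w : ∀ x → T (adj G b x ∧ not ((full - a - w) x)) → x ≡ w
    only-w x bx∈G∧x∉S with Equivalence.to (T-∧ {adj G b x}) bx∈G∧x∉S
    ... | bx∈G , x∉S with ∉-full-minus-two {x = x} {a} {w} (∈-complement⇒∉ (full - a - w) {x} x∉S)
    ...   | inj₁ refl = ⊥-elim (ab∉G (subst T (adj-sym G b a) bx∈G))
    ...   | inj₂ x≡w  = x≡w

module Corollary (k : ℕ) (G : Graph (5 + k)) {l m : ℕ}
                 (λ≡l : IsEdgeConnectivity G l) (μ≡m : IsMuK (3 + k) G m) where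

  d : ℕ
  d = 3 + k

  3≤d : 3 ≤ d
  3≤d = m≤m+n 3 k

  l≤deg : ∀ w → l ≤ deg G w
  l≤deg zero    = edgeConnectivity≤deg G λ≡l (suc zero) zero (λ ())
  l≤deg (suc w) = edgeConnectivity≤deg G λ≡l zero (suc w) (λ ())

  l<2d : l < 2 * d
  l<2d = ≤-trans (s≤s (≤-trans (l≤deg zero) (count≤n (adj G zero)))) (+-mono-≤ 3≤d (m≤m+n d 0))

  |∁S|≡2 : (S : Fin (5 + k) → Bool) → count S ≡ d → count (not ∘ S) ≡ 2
  |∁S|≡2 S |S|≡d = +-cancelˡ-≡ d _ 2 (begin
    d + count (not ∘ S)       ≡⟨ cong (_+ count (not ∘ S)) |S|≡d ⟨
    count S + count (not ∘ S) ≡⟨ count-complement S ⟩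
    2 + d                     ≡⟨ +-comm 2 d ⟩
    d + 2                     ∎)
    where open ≡-Reasoning

  m≤2 : m ≤ 2
  m≤2 with proj₂ μ≡m
  ... | S , |S|≡d , μ-max = at-terminal (count-witness S (≤-trans (s≤s z≤n) 3≤|S|))
    where
    3≤|S| : 3 ≤ count S
    3≤|S| = subst (3 ≤_) (sym |S|≡d) 3≤d
    at-terminal : ∃[ b ] b ∈ S → m ≤ 2
    at-terminal (b , b∈S) = s≤s⁻¹ (maximum<bound μ-max (outside-neighbours⇒no-packing S 3≤|S| b∈S (begin
      count (λ x → adj G b x ∧ not (S x)) ≤⟨ count-mono (λ x → proj₂ ∘ Equivalence.to (T-∧ {adj G b x})) ⟩
      count (not ∘ S)                     ≡⟨ |∁S|≡2 S |S|≡d ⟩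
      2                                   ∎)))
      where open ≤-Reasoning

  d≤l⇒1≤m : d ≤ l → 1 ≤ m
  d≤l⇒1≤m d≤l with proj₂ μ≡m
  ... | S , |S|≡d , _ , maximal =
    maximal 1 (min-degree⇒packing G S (|∁S|≡2 S |S|≡d) (λ w → ≤-trans d≤l (l≤deg w)))

  lower : floorDiv l d ≤ m
  lower with l <? d
  ... | yes l<d = subst (_≤ m) (sym (m<n⇒m/n≡0 l<d)) z≤n
  ... | no  l≮d = ≤-trans (s≤s⁻¹ (m<n*o⇒m/o<n l<2d)) (d≤l⇒1≤m (≮⇒≥ l≮d))

  l≡0⇒m≤0 : l ≡ 0 → m ≤ 0
  l≡0⇒m≤0 l≡0 = no-tree (edgeConnectivity≡0⇒disconnected G (subst (IsEdgeConnectivity G) l≡0 λ≡l))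
    where
    no-tree : ∃[ u ] ∃[ v ] ¬ Reach (adj G) u v → m ≤ 0
    no-tree (_ , _ , u↛v) =
      let (S , |S|≡d , no-packing) = disconnected⇒no-pendant-tree G (m≤m+n 4 (1 + k)) u↛v
      in μₖ≤ μ≡m S |S|≡d no-packing

  l≤d⇒m≤1 : l ≤ d → m ≤ 1
  l≤d⇒m≤1 l≤d = [ not-complete , no-trees ] (complete-or-nonadjacent G)
    where
    not-complete : Complete G → m ≤ 1
    not-complete complete =
      let (F , F-edges , (_ , _ , separated) , |F|≡l) = proj₁ λ≡l
          4+k≤l = subst (4 + k ≤_) |F|≡l (CompleteCut.complete-cut-size G complete F-edges separated)
      in ⊥-elim (<⇒≱ (s≤s l≤d) 4+k≤l)
    no-trees : ∃[ a ] ∃[ b ] (a ≢ b × ¬ T (adj G a b)) → m ≤ 1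
    no-trees (_ , _ , a≢b , ab∉G) =
      let (S , |S|≡d , no-packing) = nonadjacent⇒no-two-pendant-trees G (m≤m+n 5 k) a≢b ab∉G
      in μₖ≤ μ≡m S |S|≡d no-packing

  upper : m ≤ ceilDiv l d
  upper with l ≤? d | l ℕ.≟ 0
  ... | yes _   | yes l≡0 = ≤-trans (l≡0⇒m≤0 l≡0) z≤n
  ... | yes l≤d | no  l≢0 = ≤-trans (l≤d⇒m≤1 l≤d)
          (subst (_≤ (l + (2 + k)) / d) (n/n≡1 d) (/-monoˡ-≤ d (+-monoˡ-≤ (2 + k) (n≢0⇒n>0 l≢0))))
  ... | no  l≰d | _       = ≤-trans m≤2
          (subst (_≤ (l + (2 + k)) / d) (m*n/n≡m 2 d) (/-monoˡ-≤ d (begin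
            2 * d               ≡⟨ cong (d +_) (+-identityʳ d) ⟩
            d + d               ≡⟨ +-suc d (2 + k) ⟩
            (4 + k) + (2 + k)   ≤⟨ +-monoˡ-≤ (2 + k) (≰⇒> l≰d) ⟩
            l + (2 + k)         ∎)))
    where open ≤-Reasoning

corollary2p3 : ∀ (n : ℕ) (G : Graph n) → 5 ≤ n → ∀ (l m : ℕ) →
    IsEdgeConnectivity G l → IsMuK (n ∸ 2) G m →
    floorDiv l (n ∸ 2) ≤ m × m ≤ ceilDiv l (n ∸ 2)
corollary2p3 (suc (suc (suc (suc (suc k))))) G (s≤s (s≤s (s≤s (s≤s (s≤s z≤n))))) l m λ≡l μ≡m = lower , upper
  where open Corollary k G λ≡l μ≡m
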